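{- Let $n\in\mathbb{N}$, let $R\subseteq\mathbb{Z}_n$ be nonempty, and suppose the family $\mathcal{F}=\{g+R: g\in\mathbb{Z}_n\}$ of cyclic translates of $R$ has exactly $n$ members. Fix $A\in\mathcal{F}$, so that $\mathcal{F}=\{A+i: i=0,1,\dots,n-1\}$, and fix an enumeration $A=\{A(1),A(2),\dots,A(|A|)\}$ of the elements of $A$. Let $I\subseteq\{0,1,\dots,n-1\}$, let $q\colon I\to I$ be a bijection, and let $r\in\mathbb{Z}_n$ be such that (i) $I=r-I$ (computed in $\mathbb{Z}_n$, identifying $\{0,\dots,n-1\}$ with $\mathbb{Z}_n$), and (ii) $r-i=q(r-q(i))$ for all $i\in I$. Define, for $i\in\{0,\dots,n-1\}$, $$P_{I,q}(A+i)=\begin{cases} A+i & \text{if } i\notin I,\\ \{A(1)+q(i)\}\cup\{A(b)+i: 2\le b\le |A|\} & \text{if } i\in I.\end{cases}$$ Let $\mathcal{F}'=\{P_{I,q}(A+i): i=0,1,\dots,n-1\}$. Then the union closed family $\langle\mathcal{F}'\rangle$ generated by $\mathcal{F}'$ satisfies the Union Closed Conjecture: there is an element of $\mathbb{Z}_n$ that belongs to at least half of the members of $\langle\mathcal{F}'\rangle$.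
   Context: For $g\in\mathbb{Z}_n$ and $S\subseteq\mathbb{Z}_n$, $g+S=\{g+s:s\in S\}$ and $r-S=\{r-s:s\in S\}$. For a family $\mathcal{F}$ of sets, $\langle\mathcal{F}\rangle$ denotes the family of all unions of subfamilies of $\mathcal{F}$, including the empty set; it is union closed (closed under pairwise unions). A union closed family satisfies the Union Closed Conjecture if some element of its universe lies in at least half of its member sets. -}

module Defs where

open import Data.Nat as ℕ using (ℕ; zero; suc; _≤_; _*_)
open import Data.Nat.DivMod using (_mod_)
open import Data.Fin using (Fin; toℕ) renaming (zero to fzero; suc to fsuc)
open import Data.Fin.Subset using (Subset; _∈_; ⋃; ⁅_⁆; _∪_)
open import Data.Fin.Subset.Properties using (_∈?_)
open import Data.List using (List; map; filter; allFin; length)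
open import Data.List.Relation.Unary.Unique.Propositional using (Unique)
open import Data.List.Membership.Propositional renaming (_∈_ to _∈ₗ_)
open import Data.Vec using (lookup)
open import Data.Bool using (if_then_else_)
open import Data.Product using (Σ; ∃; _×_)
open import Function.Bundles using (_⇔_)
open import Relation.Binary.PropositionalEquality using (_≡_)

infixl 6 _⊕_ _⊖_
_⊕_ : ∀ {n} → Fin n → Fin n → Fin n
_⊕_ {suc m} i j = (toℕ i ℕ.+ toℕ j) mod (suc m)

_⊖_ : ∀ {n} → Fin n → Fin n → Fin n
_⊖_ {suc m} i j = (toℕ i ℕ.+ (suc m ℕ.∸ toℕ j)) mod (suc m)

image : ∀ {n} → (Fin n → Fin n) → Subset n → Subset n
image {n} f S = ⋃ (map (λ s → ⁅ f s ⁆) (filter (_∈? S) (allFin n)))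

translate : ∀ {n} → Fin n → Subset n → Subset n
translate g S = image (g ⊕_) S

reflect : ∀ {n} → Fin n → Subset n → Subset n
reflect r S = image (r ⊖_) S

-- The modified family member P_{I,q}(A+i), where the enumeration of A is
-- e : Fin (suc k) → Fin n, with A(1) = e zero and A(b+2) = e (suc b).
P : ∀ {n k} → Subset n → (Fin (suc k) → Fin n) → Subset n → (Fin n → Fin n)
  → Fin n → Subset n
P {n} {k} A e I q i =
  if lookup I i
  then ⁅ e fzero ⊕ q i ⁆ ∪ ⋃ (map (λ b → ⁅ e (fsuc b) ⊕ i ⁆) (allFin k))
  else translate i A

unionOf : ∀ {n m} → (Fin m → Subset n) → Subset m → Subset n
unionOf {n} {m} G J = ⋃ (map G (filter (_∈? J) (allFin m)))

InGenerated : ∀ {n m} → (Fin m → Subset n) → Subset n → Set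
InGenerated G U = ∃ λ J → U ≡ unionOf G J

-- Members are counted via any duplicate-free
-- list enumerating exactly the members of the family.
SatisfiesUCC : ∀ {n} → (Subset n → Set) → Set
SatisfiesUCC {n} Fam =
  (L : List (Subset n)) → Unique L → (∀ U → (U ∈ₗ L) ⇔ Fam U) →
  ∃ λ (x : Fin n) → length L ≤ 2 * length (filter (x ∈?_) L)

-- Put τ x = (A(1) + r) − x and let q̃ extend q by the identity outside I. Every member
-- P(A+i) is {A(1) + q̃ i} ∪ {A(b) + i : b ≥ 2}, and (ii) says q̃ (r − q̃ i) = r − i; together
-- they make the family self-dual: x ∈ P(A+i) implies τ i ∈ P(A+τ x). For such a family
-- U* = ⋃ {P(A+j) : τ j ∉ U} is an involution of ⟨F'⟩, and x ∈ U* iff P(A+τ x) ⊄ U. Since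
-- i ↦ A(1) + q̃ i is a bijection choosing a point of each P(A+i), every x lies in U* or the
-- point chosen in P(A+τ x) lies in U, so |U*| + |U| ≥ n. Summing over ⟨F'⟩, which U ↦ U*
-- permutes, gives 2 Σ |U| ≥ n |⟨F'⟩|, so some element lies in at least half of the members.

{-# OPTIONS --safe #-}
module Submission where

open import Defs
open import Data.Nat using (ℕ; zero; suc; _+_; _*_; _∸_; _%_; _≤_; _≤?_; z≤n; s≤s)
open import Data.Nat.Properties as ℕ
  using (+-comm; +-assoc; +-identityʳ; *-identityʳ; *-zeroʳ; *-suc; ≤-trans; ≤-reflexive;
         +-mono-≤; +-monoˡ-≤; +-cancelˡ-≤; +-cancelʳ-≤; <⇒≤; ≰⇒>; module ≤-Reasoning)
open import Data.Nat.DivMod using (_mod_; %-distribˡ-+; m%n%n≡m%n; [m+n]%n≡m%n; m<n⇒m%n≡m)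
open import Data.Nat.ListAction using (sum)
open import Data.Nat.ListAction.Properties using (sum-↭)
open import Data.Fin using (Fin; toℕ) renaming (zero to fzero; suc to fsuc)
open import Data.Fin.Properties using (toℕ-fromℕ<; fromℕ<-cong; toℕ-injective; toℕ<n; ¬Fin0)
open import Data.Fin.Permutation using (Permutation′; permutation; _⟨$⟩ʳ_; _∘ₚ_)
open import Data.Fin.Subset using (Subset; _∈_; _∉_; _⊆_; ⋃; ⁅_⁆; ∁; Nonempty)
open import Data.Fin.Subset.Properties
  using (_∈?_; x∈p∪q⁻; x∈p∪q⁺; x∈⁅x⁆; x∈⁅y⁆⇒x≡y; ∉⊥; ⊆-antisym; x∈∁p⇒x∉p; x∉p⇒x∈∁p)
open import Data.List using (List; []; _∷_; map; filter; allFin; length)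
open import Data.List.Properties using (map-∘; map-id-local)
open import Data.List.Membership.Propositional using () renaming (_∈_ to _∈ₗ_)
open import Data.List.Membership.Propositional.Properties
  using (∈-map⁺; ∈-map⁻; ∈-filter⁺; ∈-filter⁻; ∈-allFin)
open import Data.List.Membership.Propositional.Properties.WithK using (unique∧set⇒bag)
open import Data.List.Relation.Binary.BagAndSetEquality using (∼bag⇒↭)
open import Data.List.Relation.Binary.Permutation.Propositional using (_↭_)
import Data.List.Relation.Binary.Permutation.Propositional.Properties as ↭
open import Data.List.Relation.Unary.Any using (here; there)
import Data.List.Relation.Unary.All as All
open import Data.List.Relation.Unary.Unique.Propositional using (Unique)
import Data.List.Relation.Unary.Unique.Propositional.Properties as Unique
open import Data.Vec using (lookup)
open import Data.Vec.Properties using ([]=⇒lookup; lookup⇒[]=)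
open import Data.Bool using (true; false; if_then_else_)
open import Data.Empty using (⊥-elim)
open import Data.Product as Product using (∃; _×_; _,_; proj₂)
open import Data.Sum using (_⊎_; inj₁; inj₂)
open import Function using (_∘_; id; case_of_)
open import Function.Bundles using (_⇔_; mk⇔; Equivalence)
open import Relation.Nullary using (Dec; yes; no; contradiction)
open import Relation.Nullary.Decidable using (decidable-stable)
open import Relation.Binary.PropositionalEquality
open import Algebra.Properties.CommutativeSemigroup ℕ.+-commutativeSemigroup using (interchange)
open import Algebra.Properties.CommutativeMonoid.Sum ℕ.+-0-commutativeMonoid
  using (sum-syntax; sum-permute; ∑-distrib-+; sum-cong-≗; sum-replicate-zero)
open import Algebra.Properties.Semiring.Sum ℕ.+-*-semiring using (*-distribˡ-sum)

private
  variable
    m n : ℕ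

%-absorbˡ-+ : ∀ a b → (a % suc m + b) % suc m ≡ (a + b) % suc m
%-absorbˡ-+ {m} a b = begin
  (a % suc m + b) % suc m                  ≡⟨ %-distribˡ-+ (a % suc m) b (suc m) ⟩
  (a % suc m % suc m + b % suc m) % suc m  ≡⟨ cong (λ z → (z + b % suc m) % suc m) (m%n%n≡m%n a (suc m)) ⟩
  (a % suc m + b % suc m) % suc m          ≡⟨ %-distribˡ-+ a b (suc m) ⟨
  (a + b) % suc m                          ∎
  where open ≡-Reasoning

mod-cong : ∀ a b → a % suc m ≡ b % suc m → a mod suc m ≡ b mod suc m
mod-cong a b eq = fromℕ<-cong (a % _) (b % _) eq _ _

toℕ-mod : ∀ a → toℕ (a mod suc m) ≡ a % suc m
toℕ-mod a = toℕ-fromℕ< _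

mod-toℕ : (i : Fin (suc m)) → toℕ i mod suc m ≡ i
mod-toℕ i = toℕ-injective (trans (toℕ-mod (toℕ i)) (m<n⇒m%n≡m (toℕ<n i)))

mod-absorbˡ : ∀ a b → (toℕ (a mod suc m) + b) mod suc m ≡ (a + b) mod suc m
mod-absorbˡ {m} a b = mod-cong (toℕ (a mod suc m) + b) (a + b)
  (trans (cong (λ z → (z + b) % suc m) (toℕ-mod a)) (%-absorbˡ-+ a b))

mod-absorbʳ : ∀ a b → (a + toℕ (b mod suc m)) mod suc m ≡ (a + b) mod suc m
mod-absorbʳ {m} a b = begin
  (a + toℕ (b mod suc m)) mod suc m  ≡⟨ cong (_mod suc m) (+-comm a _) ⟩
  (toℕ (b mod suc m) + a) mod suc m  ≡⟨ mod-absorbˡ b a ⟩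
  (b + a) mod suc m                  ≡⟨ cong (_mod suc m) (+-comm b a) ⟩
  (a + b) mod suc m                  ∎
  where open ≡-Reasoning

⊕-comm : (i j : Fin (suc m)) → i ⊕ j ≡ j ⊕ i
⊕-comm {m} i j = cong (_mod suc m) (+-comm (toℕ i) (toℕ j))

⊕-assoc : (i j k : Fin (suc m)) → (i ⊕ j) ⊕ k ≡ i ⊕ (j ⊕ k)
⊕-assoc {m} i j k = begin
  (i ⊕ j) ⊕ k                            ≡⟨ mod-absorbˡ (toℕ i + toℕ j) (toℕ k) ⟩
  (toℕ i + toℕ j + toℕ k) mod suc m      ≡⟨ cong (_mod suc m) (+-assoc (toℕ i) (toℕ j) (toℕ k)) ⟩
  (toℕ i + (toℕ j + toℕ k)) mod suc m    ≡⟨ mod-absorbʳ (toℕ i) (toℕ j + toℕ k) ⟨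
  i ⊕ (j ⊕ k)                            ∎
  where open ≡-Reasoning

[x⊖y]⊕y≡x : (x y : Fin (suc m)) → (x ⊖ y) ⊕ y ≡ x
[x⊖y]⊕y≡x {m} x y = begin
  (x ⊖ y) ⊕ y                                   ≡⟨ mod-absorbˡ (toℕ x + (suc m ∸ toℕ y)) (toℕ y) ⟩
  (toℕ x + (suc m ∸ toℕ y) + toℕ y) mod suc m   ≡⟨ cong (_mod suc m) (+-assoc (toℕ x) _ (toℕ y)) ⟩
  (toℕ x + (suc m ∸ toℕ y + toℕ y)) mod suc m   ≡⟨ cong (λ z → (toℕ x + z) mod suc m) (ℕ.m∸n+n≡m (<⇒≤ (toℕ<n y))) ⟩
  (toℕ x + suc m) mod suc m                     ≡⟨ mod-cong (toℕ x + suc m) (toℕ x) ([m+n]%n≡m%n (toℕ x) (suc m)) ⟩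
  toℕ x mod suc m                               ≡⟨ mod-toℕ x ⟩
  x                                             ∎
  where open ≡-Reasoning

[x⊕y]⊖y≡x : (x y : Fin (suc m)) → (x ⊕ y) ⊖ y ≡ x
[x⊕y]⊖y≡x {m} x y = begin
  (x ⊕ y) ⊖ y                                   ≡⟨ mod-absorbˡ (toℕ x + toℕ y) (suc m ∸ toℕ y) ⟩
  (toℕ x + toℕ y + (suc m ∸ toℕ y)) mod suc m   ≡⟨ cong (_mod suc m) (+-assoc (toℕ x) (toℕ y) _) ⟩
  (toℕ x + (toℕ y + (suc m ∸ toℕ y))) mod suc m ≡⟨ cong (λ z → (toℕ x + z) mod suc m) (ℕ.m+[n∸m]≡n (<⇒≤ (toℕ<n y))) ⟩
  (toℕ x + suc m) mod suc m                     ≡⟨ mod-cong (toℕ x + suc m) (toℕ x) ([m+n]%n≡m%n (toℕ x) (suc m)) ⟩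
  toℕ x mod suc m                               ≡⟨ mod-toℕ x ⟩
  x                                             ∎
  where open ≡-Reasoning

z⊕y≡x⇒x⊖y≡z : {x y z : Fin (suc m)} → z ⊕ y ≡ x → x ⊖ y ≡ z
z⊕y≡x⇒x⊖y≡z {z = z} refl = [x⊕y]⊖y≡x z _

x⊖[x⊖y]≡y : (x y : Fin (suc m)) → x ⊖ (x ⊖ y) ≡ y
x⊖[x⊖y]≡y x y = z⊕y≡x⇒x⊖y≡z (trans (⊕-comm y (x ⊖ y)) ([x⊖y]⊕y≡x x y))

[a⊕x]⊖[a⊕y]≡x⊖y : (a x y : Fin (suc m)) → (a ⊕ x) ⊖ (a ⊕ y) ≡ x ⊖ y
[a⊕x]⊖[a⊕y]≡x⊖y a x y = z⊕y≡x⇒x⊖y≡z (begin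
  (x ⊖ y) ⊕ (a ⊕ y)  ≡⟨ cong ((x ⊖ y) ⊕_) (⊕-comm a y) ⟩
  (x ⊖ y) ⊕ (y ⊕ a)  ≡⟨ ⊕-assoc (x ⊖ y) y a ⟨
  ((x ⊖ y) ⊕ y) ⊕ a  ≡⟨ cong (_⊕ a) ([x⊖y]⊕y≡x x y) ⟩
  x ⊕ a              ≡⟨ ⊕-comm x a ⟩
  a ⊕ x              ∎)
  where open ≡-Reasoning

x⊖y≡a⊕[x⊖[a⊕y]] : (x y a : Fin (suc m)) → x ⊖ y ≡ a ⊕ (x ⊖ (a ⊕ y))
x⊖y≡a⊕[x⊖[a⊕y]] {m} x y a = z⊕y≡x⇒x⊖y≡z (begin
  (a ⊕ t) ⊕ y  ≡⟨ cong (_⊕ y) (⊕-comm a t) ⟩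
  (t ⊕ a) ⊕ y  ≡⟨ ⊕-assoc t a y ⟩
  t ⊕ (a ⊕ y)  ≡⟨ [x⊖y]⊕y≡x x (a ⊕ y) ⟩
  x            ∎)
  where
  open ≡-Reasoning
  t : Fin (suc m)
  t = x ⊖ (a ⊕ y)

[a⊕x]⊖y≡a⊕[x⊖y] : (a x y : Fin (suc m)) → (a ⊕ x) ⊖ y ≡ a ⊕ (x ⊖ y)
[a⊕x]⊖y≡a⊕[x⊖y] a x y =
  trans (x⊖y≡a⊕[x⊖[a⊕y]] (a ⊕ x) y a) (cong (a ⊕_) ([a⊕x]⊖[a⊕y]≡x⊖y a x y))

translation : Fin (suc m) → Permutation′ (suc m)
translation a = permutation (a ⊕_) (_⊖ a)
  (λ y → trans (⊕-comm a (y ⊖ a)) ([x⊖y]⊕y≡x y a))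
  (λ x → trans (cong (_⊖ a) (⊕-comm a x)) ([x⊕y]⊖y≡x x a))

∈-⋃-map⁻ : ∀ {A : Set} {F : A → Subset n} {x} (as : List A) →
           x ∈ ⋃ (map F as) → ∃ λ a → a ∈ₗ as × x ∈ F a
∈-⋃-map⁻ [] x∈ = ⊥-elim (∉⊥ x∈)
∈-⋃-map⁻ {F = F} (a ∷ as) x∈ with x∈p∪q⁻ (F a) _ x∈
... | inj₁ x∈Fa = a , here refl , x∈Fa
... | inj₂ x∈⋃  = Product.map₂ (Product.map₁ there) (∈-⋃-map⁻ as x∈⋃)

∈-⋃-map⁺ : ∀ {A : Set} {F : A → Subset n} {x a as} → a ∈ₗ as → x ∈ F a → x ∈ ⋃ (map F as)
∈-⋃-map⁺ (here refl) x∈ = x∈p∪q⁺ (inj₁ x∈)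
∈-⋃-map⁺ (there a∈) x∈ = x∈p∪q⁺ (inj₂ (∈-⋃-map⁺ a∈ x∈))

∈-unionOf⁻ : ∀ {G : Fin m → Subset n} {J x} → x ∈ unionOf G J → ∃ λ i → i ∈ J × x ∈ G i
∈-unionOf⁻ {m} {J = J} x∈ =
  Product.map₂ (Product.map₁ (proj₂ ∘ ∈-filter⁻ (_∈? J) {xs = allFin m}))
    (∈-⋃-map⁻ (filter (_∈? J) (allFin m)) x∈)

∈-unionOf⁺ : ∀ {G : Fin m → Subset n} {J x i} → i ∈ J → x ∈ G i → x ∈ unionOf G J
∈-unionOf⁺ {J = J} {i = i} i∈J = ∈-⋃-map⁺ (∈-filter⁺ (_∈? J) (∈-allFin i) i∈J)

∈-image⁻ : ∀ {f : Fin n → Fin n} {S x} → x ∈ image f S → ∃ λ s → s ∈ S × x ≡ f s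
∈-image⁻ x∈ = Product.map₂ (Product.map₂ (x∈⁅y⁆⇒x≡y _)) (∈-unionOf⁻ x∈)

∈-image⁺ : ∀ {f : Fin n → Fin n} {S s} → s ∈ S → f s ∈ image f S
∈-image⁺ {f = f} {s = s} s∈S = ∈-unionOf⁺ s∈S (x∈⁅x⁆ (f s))

𝟙 : ∀ {P : Set} → Dec P → ℕ
𝟙 (yes _) = 1
𝟙 (no _)  = 0

1≤𝟙 : ∀ {P : Set} (P? : Dec P) → P → 1 ≤ 𝟙 P?
1≤𝟙 (yes _) _ = s≤s z≤n
1≤𝟙 (no ¬p) p = contradiction p ¬p

card : Subset n → ℕ
card {n} U = ∑[ x < n ] 𝟙 (x ∈? U)

count : Fin n → List (Subset n) → ℕ
count x Us = length (filter (x ∈?_) Us)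

c≤f⇒n*c≤∑f : ∀ c (f : Fin n → ℕ) → (∀ i → c ≤ f i) → n * c ≤ ∑[ i < n ] f i
c≤f⇒n*c≤∑f {zero}  c f c≤f = z≤n
c≤f⇒n*c≤∑f {suc n} c f c≤f = +-mono-≤ (c≤f fzero) (c≤f⇒n*c≤∑f c (f ∘ fsuc) (c≤f ∘ fsuc))

n*c≤∑f⇒∃c≤f : ∀ c (f : Fin (suc m) → ℕ) → suc m * c ≤ ∑[ i < suc m ] f i → ∃ λ i → c ≤ f i
n*c≤∑f⇒∃c≤f {zero}  c f le = fzero , +-cancelʳ-≤ 0 c (f fzero) le
n*c≤∑f⇒∃c≤f {suc m} c f le with c ≤? f fzero
... | yes c≤f₀ = fzero , c≤f₀
... | no  c≰f₀ = Product.map fsuc id (n*c≤∑f⇒∃c≤f c (f ∘ fsuc)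
      (+-cancelˡ-≤ (f fzero) _ _ (≤-trans (+-monoˡ-≤ _ (<⇒≤ (≰⇒> c≰f₀))) le)))

sum-map-+ : ∀ {A : Set} (f g : A → ℕ) xs →
            sum (map (λ x → f x + g x) xs) ≡ sum (map f xs) + sum (map g xs)
sum-map-+ f g []       = refl
sum-map-+ f g (x ∷ xs) =
  trans (cong (f x + g x +_) (sum-map-+ f g xs)) (interchange (f x) (g x) _ _)

c≤f⇒c*length≤sum-map : ∀ {A : Set} c (f : A → ℕ) xs → (∀ {x} → x ∈ₗ xs → c ≤ f x) →
                   c * length xs ≤ sum (map f xs)
c≤f⇒c*length≤sum-map c f []       c≤f = ≤-reflexive (*-zeroʳ c)
c≤f⇒c*length≤sum-map c f (x ∷ xs) c≤f = subst (_≤ f x + sum (map f xs)) (sym (*-suc c (length xs)))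
  (+-mono-≤ (c≤f (here refl)) (c≤f⇒c*length≤sum-map c f xs (λ x∈ → c≤f (there x∈))))

sum-map-card : (Us : List (Subset n)) → sum (map card Us) ≡ ∑[ x < n ] count x Us
sum-map-card {n} []       = sym (sum-replicate-zero n)
sum-map-card {n} (U ∷ Us) = begin
  card U + sum (map card Us)                  ≡⟨ cong (card U +_) (sum-map-card Us) ⟩
  card U + ∑[ x < n ] count x Us              ≡⟨ ∑-distrib-+ (λ x → 𝟙 (x ∈? U)) (λ x → count x Us) ⟨
  ∑[ x < n ] (𝟙 (x ∈? U) + count x Us)        ≡⟨ sum-cong-≗ count-∷ ⟩
  ∑[ x < n ] count x (U ∷ Us)                 ∎
  where
  open ≡-Reasoning
  count-∷ : ∀ x → 𝟙 (x ∈? U) + count x Us ≡ count x (U ∷ Us)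
  count-∷ x with x ∈? U
  ... | yes _ = refl
  ... | no  _ = refl

map-involution-↭ : ∀ {A : Set} (f : A → A) {xs} → Unique xs →
                   (∀ {x} → x ∈ₗ xs → f x ∈ₗ xs) → (∀ {x} → x ∈ₗ xs → f (f x) ≡ x) →
                   map f xs ↭ xs
map-involution-↭ f {xs} xs! f∈ ff≡ = ∼bag⇒↭ (unique∧set⇒bag fxs! xs! (mk⇔ to from))
  where
  ffxs≡xs : map f (map f xs) ≡ xs
  ffxs≡xs = trans (sym (map-∘ {g = f} {f = f} xs)) (map-id-local (All.tabulate ff≡))
  fxs! : Unique (map f xs)
  fxs! = Unique.map⁻ (subst Unique (sym ffxs≡xs) xs!)
  to : ∀ {y} → y ∈ₗ map f xs → y ∈ₗ xs
  to y∈ with ∈-map⁻ f y∈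
  ... | x , x∈ , refl = f∈ x∈
  from : ∀ {y} → y ∈ₗ xs → y ∈ₗ map f xs
  from y∈ = subst (_∈ₗ map f xs) (ff≡ y∈) (∈-map⁺ f (f∈ y∈))

module SelfDual {m : ℕ} (G : Fin (suc m) → Subset (suc m))
  (τ : Fin (suc m) → Fin (suc m)) (τ-involutive : ∀ x → τ (τ x) ≡ x)
  (G-dual : ∀ {x i} → x ∈ G i → τ i ∈ G (τ x))
  (π : Permutation′ (suc m)) (π∈G : ∀ i → π ⟨$⟩ʳ i ∈ G i)
  where

  G-sym : ∀ {x y} → y ∈ G (τ x) → x ∈ G (τ y)
  G-sym {x} y∈ = subst (λ z → z ∈ G _) (τ-involutive x) (G-dual y∈)

  τ-injective : ∀ {x y} → τ x ≡ τ y → x ≡ y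
  τ-injective {x} {y} eq = trans (sym (τ-involutive x)) (trans (cong τ eq) (τ-involutive y))

  dual : Subset (suc m) → Subset (suc m)
  dual U = unionOf G (∁ (image τ U))

  ∈-dual⁻ : ∀ {U x} → x ∈ dual U → ∃ λ y → y ∈ G (τ x) × y ∉ U
  ∈-dual⁻ {U} x∈ with ∈-unionOf⁻ {G = G} x∈
  ... | j , j∈ , x∈Gj = τ j , G-dual x∈Gj , λ τj∈U →
    x∈∁p⇒x∉p j∈ (subst (_∈ image τ U) (τ-involutive j) (∈-image⁺ τj∈U))

  ∈-dual⁺ : ∀ {U x y} → y ∈ G (τ x) → y ∉ U → x ∈ dual U
  ∈-dual⁺ {U} {x} {y} y∈ y∉U = ∈-unionOf⁺ {G = G} (x∉p⇒x∈∁p τy∉τ[U]) (G-sym y∈)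
    where
    τy∉τ[U] : τ y ∉ image τ U
    τy∉τ[U] τy∈ with ∈-image⁻ τy∈
    ... | u , u∈U , τy≡τu = y∉U (subst (_∈ U) (sym (τ-injective τy≡τu)) u∈U)

  ∉-dual⇒⊆ : ∀ {U x} → x ∉ dual U → G (τ x) ⊆ U
  ∉-dual⇒⊆ {U} x∉ {y} y∈ = decidable-stable (y ∈? U) (λ y∉U → x∉ (∈-dual⁺ y∈ y∉U))

  dual-involutive : ∀ {U} → InGenerated G U → dual (dual U) ≡ U
  dual-involutive {U} (J , refl) = ⊆-antisym ⊆U U⊆
    where
    ⊆U : dual (dual U) ⊆ U
    ⊆U x∈ with ∈-dual⁻ x∈
    ... | y , y∈ , y∉ = ∉-dual⇒⊆ y∉ (G-sym y∈)
    U⊆ : U ⊆ dual (dual U)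
    U⊆ x∈ with ∈-unionOf⁻ {G = G} {J = J} x∈
    ... | i , i∈J , x∈Gi = ∈-dual⁺ (G-dual x∈Gi) λ τi∈ → case ∈-dual⁻ τi∈ of λ where
      (z , z∈ , z∉U) → z∉U (∈-unionOf⁺ {G = G} i∈J (subst (λ j → z ∈ G j) (τ-involutive i) z∈))

  n≤card-dual+card : ∀ U → suc m ≤ card (dual U) + card U
  n≤card-dual+card U = begin
    suc m                                                  ≡⟨ *-identityʳ (suc m) ⟨
    suc m * 1                                              ≤⟨ c≤f⇒n*c≤∑f 1 _ covered ⟩
    ∑[ x < suc m ] (𝟙 (x ∈? dual U) + 𝟙 (σ ⟨$⟩ʳ x ∈? U))  ≡⟨ ∑-distrib-+ (λ x → 𝟙 (x ∈? dual U)) (λ x → 𝟙 (σ ⟨$⟩ʳ x ∈? U)) ⟩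
    card (dual U) + ∑[ x < suc m ] 𝟙 (σ ⟨$⟩ʳ x ∈? U)      ≡⟨ cong (card (dual U) +_) (sum-permute (λ x → 𝟙 (x ∈? U)) σ) ⟨
    card (dual U) + card U                                 ∎
    where
    open ≤-Reasoning
    σ : Permutation′ (suc m)
    σ = permutation τ τ τ-involutive τ-involutive ∘ₚ π
    covered : ∀ x → 1 ≤ 𝟙 (x ∈? dual U) + 𝟙 (σ ⟨$⟩ʳ x ∈? U)
    covered x with x ∈? dual U
    ... | yes _  = s≤s z≤n
    ... | no  x∉ = 1≤𝟙 (σ ⟨$⟩ʳ x ∈? U) (∉-dual⇒⊆ x∉ (π∈G (τ x)))

  satisfiesUCC : SatisfiesUCC (InGenerated G)
  satisfiesUCC L L! L⇔⟨G⟩ = n*c≤∑f⇒∃c≤f (length L) (λ x → 2 * count x L) bound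
    where
    dual-↭ : map dual L ↭ L
    dual-↭ = map-involution-↭ dual L!
      (λ {U} _ → Equivalence.from (L⇔⟨G⟩ (dual U)) (∁ (image τ U) , refl))
      (λ {U} U∈ → dual-involutive (Equivalence.to (L⇔⟨G⟩ U) U∈))
    bound : suc m * length L ≤ ∑[ x < suc m ] (2 * count x L)
    bound = begin
      suc m * length L                               ≤⟨ c≤f⇒c*length≤sum-map (suc m) _ L (λ {U} _ → n≤card-dual+card U) ⟩
      sum (map (λ U → card (dual U) + card U) L)     ≡⟨ sum-map-+ (card ∘ dual) card L ⟩
      sum (map (card ∘ dual) L) + sum (map card L)   ≡⟨ cong (_+ sum (map card L)) (trans (cong sum (map-∘ L)) (sum-↭ (↭.map⁺ card dual-↭))) ⟩
      sum (map card L) + sum (map card L)            ≡⟨ cong (sum (map card L) +_) (+-identityʳ _) ⟨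
      2 * sum (map card L)                           ≡⟨ cong (2 *_) (sum-map-card L) ⟩
      2 * (∑[ x < suc m ] count x L)                 ≡⟨ *-distribˡ-sum 2 (λ x → count x L) ⟩
      ∑[ x < suc m ] (2 * count x L)                 ∎
      where open ≤-Reasoning

module PerturbedTranslates {m k : ℕ} (A : Subset (suc m)) (e : Fin (suc k) → Fin (suc m))
  (A⇔e : ∀ x → x ∈ A ⇔ ∃ λ b → e b ≡ x)
  (I : Subset (suc m)) (q : Fin (suc m) → Fin (suc m)) (q∈I : ∀ i → i ∈ I → q i ∈ I)
  (r : Fin (suc m)) (I≡r⊖I : I ≡ reflect r I) (q-reflect : ∀ i → i ∈ I → r ⊖ i ≡ q (r ⊖ q i))
  where

  G : Fin (suc m) → Subset (suc m)
  G = P A e I q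

  -- With q̃, every member is uniformly G i = {e 0 ⊕ q̃ i} ∪ {e (1 + c) ⊕ i : c}.
  q̃ : Fin (suc m) → Fin (suc m)
  q̃ i = if lookup I i then q i else i

  q̃-∈ : ∀ {i} → i ∈ I → q̃ i ≡ q i
  q̃-∈ i∈I rewrite []=⇒lookup i∈I = refl

  q̃-∉ : ∀ {i} → i ∉ I → q̃ i ≡ i
  q̃-∉ {i} i∉I with lookup I i in eq
  ... | true  = contradiction (lookup⇒[]= i I eq) i∉I
  ... | false = refl

  r⊖-∈ : ∀ {i} → i ∈ I → r ⊖ i ∈ I
  r⊖-∈ i∈I = subst (_ ∈_) (sym I≡r⊖I) (∈-image⁺ i∈I)

  r⊖-∈⁻ : ∀ {i} → r ⊖ i ∈ I → i ∈ I
  r⊖-∈⁻ {i} = subst (_∈ I) (x⊖[x⊖y]≡y r i) ∘ r⊖-∈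

  q̃-reflect : ∀ i → r ⊖ i ≡ q̃ (r ⊖ q̃ i)
  q̃-reflect i with i ∈? I
  ... | yes i∈I = begin
    r ⊖ i          ≡⟨ q-reflect i i∈I ⟩
    q (r ⊖ q i)    ≡⟨ q̃-∈ (r⊖-∈ (q∈I i i∈I)) ⟨
    q̃ (r ⊖ q i)   ≡⟨ cong (λ j → q̃ (r ⊖ j)) (q̃-∈ i∈I) ⟨
    q̃ (r ⊖ q̃ i)  ∎
    where open ≡-Reasoning
  ... | no i∉I = begin
    r ⊖ i          ≡⟨ q̃-∉ (i∉I ∘ r⊖-∈⁻) ⟨
    q̃ (r ⊖ i)     ≡⟨ cong (λ j → q̃ (r ⊖ j)) (q̃-∉ i∉I) ⟨
    q̃ (r ⊖ q̃ i)  ∎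
    where open ≡-Reasoning

  -- q̃-reflect reads ρ = q̃ ∘ ρ ∘ q̃ for the involution ρ j = r ⊖ j, so ρ ∘ q̃ ∘ ρ inverts q̃.
  q̃ₚ : Permutation′ (suc m)
  q̃ₚ = permutation q̃ (λ j → r ⊖ q̃ (r ⊖ j))
    (λ j → trans (sym (q̃-reflect (r ⊖ j))) (x⊖[x⊖y]≡y r j))
    (λ i → trans (cong (r ⊖_) (sym (q̃-reflect i))) (x⊖[x⊖y]≡y r i))

  e∈A : ∀ b → e b ∈ A
  e∈A b = Equivalence.from (A⇔e (e b)) (b , refl)

  ∈-P⁻ : ∀ {i x} → x ∈ G i → x ≡ e fzero ⊕ q̃ i ⊎ ∃ λ c → x ≡ e (fsuc c) ⊕ i
  ∈-P⁻ {i} x∈ with lookup I i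
  ... | true with x∈p∪q⁻ ⁅ e fzero ⊕ q i ⁆ _ x∈
  ...   | inj₁ x∈head = inj₁ (x∈⁅y⁆⇒x≡y _ x∈head)
  ...   | inj₂ x∈tail = inj₂ (Product.map₂ (x∈⁅y⁆⇒x≡y _ ∘ proj₂) (∈-⋃-map⁻ (allFin k) x∈tail))
  ∈-P⁻ {i} x∈ | false with ∈-image⁻ x∈
  ... | a , a∈A , x≡i⊕a with Equivalence.to (A⇔e a) a∈A
  ...   | fzero  , refl = inj₁ (trans x≡i⊕a (⊕-comm i _))
  ...   | fsuc c , refl = inj₂ (c , trans x≡i⊕a (⊕-comm i _))

  head∈P : ∀ i → e fzero ⊕ q̃ i ∈ G i
  head∈P i with lookup I i
  ... | true  = x∈p∪q⁺ (inj₁ (x∈⁅x⁆ _))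
  ... | false = subst (_∈ translate i A) (⊕-comm i (e fzero)) (∈-image⁺ (e∈A fzero))

  tail∈P : ∀ i c → e (fsuc c) ⊕ i ∈ G i
  tail∈P i c with lookup I i
  ... | true  = x∈p∪q⁺ (inj₂ (∈-⋃-map⁺ (∈-allFin c) (x∈⁅x⁆ _)))
  ... | false = subst (_∈ translate i A) (⊕-comm i (e (fsuc c))) (∈-image⁺ (e∈A (fsuc c)))

  τ : Fin (suc m) → Fin (suc m)
  τ x = (e fzero ⊕ r) ⊖ x

  τ-involutive : ∀ x → τ (τ x) ≡ x
  τ-involutive = x⊖[x⊖y]≡y (e fzero ⊕ r)

  P-dual : ∀ {x i} → x ∈ G i → τ i ∈ G (τ x)
  P-dual {x} {i} x∈ with ∈-P⁻ x∈
  ... | inj₁ refl = subst (_∈ G (τ x)) (sym τi≡) (head∈P (τ x))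
    where
    open ≡-Reasoning
    τi≡ : τ i ≡ e fzero ⊕ q̃ (τ x)
    τi≡ = begin
      (e fzero ⊕ r) ⊖ i              ≡⟨ [a⊕x]⊖y≡a⊕[x⊖y] (e fzero) r i ⟩
      e fzero ⊕ (r ⊖ i)              ≡⟨ cong (e fzero ⊕_) (q̃-reflect i) ⟩
      e fzero ⊕ q̃ (r ⊖ q̃ i)        ≡⟨ cong (λ j → e fzero ⊕ q̃ j) ([a⊕x]⊖[a⊕y]≡x⊖y (e fzero) r (q̃ i)) ⟨
      e fzero ⊕ q̃ (τ x)             ∎
  ... | inj₂ (c , refl) =
    subst (_∈ G (τ x)) (sym (x⊖y≡a⊕[x⊖[a⊕y]] (e fzero ⊕ r) i (e (fsuc c)))) (tail∈P (τ x) c)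

  π : Permutation′ (suc m)
  π = q̃ₚ ∘ₚ translation (e fzero)

  π∈P : ∀ i → π ⟨$⟩ʳ i ∈ G i
  π∈P = head∈P

theorem2 : (n : ℕ) (R : Subset n) → Nonempty R →
    (∀ (g h : Fin n) → translate g R ≡ translate h R → g ≡ h) →
    (A : Subset n) → (∃ λ (g : Fin n) → A ≡ translate g R) →
    (k : ℕ) (e : Fin (suc k) → Fin n) →
    (∀ (b c : Fin (suc k)) → e b ≡ e c → b ≡ c) →
    (∀ (x : Fin n) → (x ∈ A) ⇔ (∃ λ b → e b ≡ x)) →
    (I : Subset n) (q : Fin n → Fin n) →
    (∀ i → i ∈ I → q i ∈ I) →
    (∀ i j → i ∈ I → j ∈ I → q i ≡ q j → i ≡ j) →
    (∀ j → j ∈ I → ∃ λ i → i ∈ I × q i ≡ j) →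
    (r : Fin n) →
    I ≡ reflect r I →
    (∀ i → i ∈ I → r ⊖ i ≡ q (r ⊖ q i)) →
    SatisfiesUCC (InGenerated (P A e I q))
theorem2 zero    _ _ _ _ _ _ e _ _ _ _ _ _ _ _ _ _ = ⊥-elim (¬Fin0 (e fzero))
theorem2 (suc m) _ _ _ A _ k e _ A⇔e I q q∈I _ _ r I≡r⊖I q-reflect =
  SelfDual.satisfiesUCC G τ τ-involutive P-dual π π∈P
  where open PerturbedTranslates A e A⇔e I q q∈I r I≡r⊖I q-reflect
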